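{- Let $G$ be the Galois group of a Galois number field $K$ of degree $n$, let $p$ be an odd rational prime splitting completely in $K$, and let $l\neq 2$ be a prime dividing $p-1$. Then $I/lI\cong B_l$ as $\mathbb{F}_l[G]$-modules.
   Context: $I$ is the kernel of the trace map $(\mathbb{Z}/(p-1)\mathbb{Z})[G]\to\mathbb{Z}/\frac{p-1}{2}\mathbb{Z}$, $\sum a_g[g]\mapsto\sum a_g$, with $G$ acting by left multiplication. $B_l=\{\sum_{g}x_g[g]\in\mathbb{F}_l[G]:\sum_g x_g=0\}$. -}

module Defs where

open import Data.Nat as ℕ using (ℕ; zero; suc; _∸_)
open import Data.Nat.DivMod using (_/_)
open import Data.Fin using (Fin; zero; suc)
open import Data.Integer as ℤ using (ℤ; +_; _+_; _-_; _*_)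
open import Data.Integer.Divisibility using (_∣_)
open import Data.Product using (Σ; _×_; _,_; ∃)
open import Relation.Binary.PropositionalEquality using (_≡_)

record FiniteGroup (n : ℕ) : Set where
  field
    _·_   : Fin n → Fin n → Fin n
    e     : Fin n
    inv   : Fin n → Fin n
    assoc : ∀ x y z → (x · y) · z ≡ x · (y · z)
    idˡ   : ∀ x → e · x ≡ x
    invˡ  : ∀ x → inv x · x ≡ e

ΣFin : ∀ {n} → (Fin n → ℤ) → ℤ
ΣFin {zero}  f = + 0
ΣFin {suc n} f = f zero + ΣFin (λ i → f (suc i))

-- Group-ring elements Σ_g x_g [g] with integer representatives of the coefficients.
GR : ℕ → Set
GR n = Fin n → ℤ

_⊕_ : ∀ {n} → GR n → GR n → GR n
(x ⊕ y) g = x g + y g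

_⊖_ : ∀ {n} → GR n → GR n → GR n
(x ⊖ y) g = x g - y g

scale : ∀ {n} → ℤ → GR n → GR n
scale c x g = c * x g

-- Left multiplication action: g · (Σ x_h [h]) = Σ x_h [g h], i.e. coefficient at h is x_{g⁻¹ h}.
act : ∀ {n} → FiniteGroup n → Fin n → GR n → GR n
act G g x h = x (inv g · h) where open FiniteGroup G

-- Coefficientwise congruence mod m (equality in (ℤ/m)[G]).
_≈[_]_ : ∀ {n} → GR n → ℕ → GR n → Set
x ≈[ m ] y = ∀ g → (+ m) ∣ (x g - y g)

-- I ⊆ (ℤ/(p-1))[G]: kernel of the trace to ℤ/((p-1)/2).
InI : ∀ {n} → ℕ → GR n → Set
InI p x = (+ ((p ∸ 1) / 2)) ∣ ΣFin x

-- Equality in the quotient I/lI (on representatives in I): x − y ∈ lI inside (ℤ/(p-1))[G].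
IlI-eq : ∀ {n} → ℕ → ℕ → GR n → GR n → Set
IlI-eq {n} p l x y = ∃ λ (z : GR n) → InI p z × ((x ⊖ y) ≈[ p ∸ 1 ] scale (+ l) z)

-- B_l ⊆ 𝔽_l[G]: augmentation-zero elements (representatives with integer coefficients).
InB : ∀ {n} → ℕ → GR n → Set
InB l x = (+ l) ∣ ΣFin x

-- An isomorphism of 𝔽_l[G]-modules I/lI ≅ B_l, given on representatives.
-- (𝔽_l[G]-linearity = additivity + G-equivariance; 𝔽_l-scalars are integer multiples.)
record ModIso {n : ℕ} (G : FiniteGroup n) (p l : ℕ) : Set where
  field
    φ       : GR n → GR n
    ψ       : GR n → GR n
    φ-into  : ∀ x → InI p x → InB l (φ x)
    ψ-into  : ∀ y → InB l y → InI p (ψ y)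
    φ-resp  : ∀ x x′ → InI p x → InI p x′ → IlI-eq p l x x′ → φ x ≈[ l ] φ x′
    ψ-resp  : ∀ y y′ → InB l y → InB l y′ → y ≈[ l ] y′ → IlI-eq p l (ψ y) (ψ y′)
    ψφ      : ∀ x → InI p x → IlI-eq p l (ψ (φ x)) x
    φψ      : ∀ y → InB l y → φ (ψ y) ≈[ l ] y
    φ-add   : ∀ x x′ → InI p x → InI p x′ → φ (x ⊕ x′) ≈[ l ] (φ x ⊕ φ x′)
    φ-equiv : ∀ g x → InI p x → φ (act G g x) ≈[ l ] act G g (φ x)

module Submission where

-- Write m = p - 1 and h = m/2.  Both modules live on representatives in ℤ[G],
-- so the isomorphism can be taken to be the identity on representatives in
-- one direction; in the other direction an element y of B_l is first
-- normalised (its trace is subtracted from its first coefficient) so that it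
-- lands in I.  Everything then rests on one description of the equality of
-- I/lI: for x, y ∈ I,
--     x ≡ y in I/lI   ⟺   x ≡ y coefficientwise mod l.
-- "⟹" only needs l ∣ m.  "⟸" writes x - y = l·w and corrects w at one
-- coefficient by (Σ w)(l - 1); this lands in I because h ∣ Σ(x - y), and the
-- correction is invisible mod m because m ∣ h(l - 1).

open import Defs
open import Data.Nat using (ℕ; _∸_)
open import Data.Nat.Divisibility using (_∣_)
open import Data.Nat.Primality using (Prime)
open import Relation.Binary.PropositionalEquality using (_≢_)

open import Data.Nat as ℕ using (zero; suc; NonZero)
import Data.Nat.Properties as ℕP
import Data.Nat.Divisibility as ℕ∣
open import Data.Nat.DivMod using (_/_; m*[n/m]≡n)
open import Data.Nat.Primality
  using (euclidsLemma; prime⇒irreducible; prime⇒nonZero; prime[2]; ¬prime[0]; ¬prime[1])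
open import Data.Integer using (ℤ; +_; _+_; _-_; _*_; -_)
import Data.Integer.Properties as ℤP
open import Data.Integer.Divisibility.Signed as ℤ∣ using () renaming (_∣_ to _∣ℤ_)
open import Data.Integer.Tactic.RingSolver using (solve-∀)
open import Data.Fin using (zero; suc)
open import Data.Product using (_,_)
open import Data.Sum using (_⊎_; inj₁; inj₂)
open import Data.Empty using (⊥-elim)
open import Function using (id)
open import Relation.Binary.PropositionalEquality
  using (_≡_; refl; sym; trans; cong; cong₂; subst; module ≡-Reasoning)

even-or-succ-even : ∀ n → 2 ∣ n ⊎ 2 ∣ suc n
even-or-succ-even zero = inj₁ (ℕ∣.divides 0 refl)
even-or-succ-even (suc n) with even-or-succ-even n
... | inj₁ 2∣n   = inj₂ (ℕ∣.∣m∣n⇒∣m+n (ℕ∣.∣-refl {2}) 2∣n)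
... | inj₂ 2∣1+n = inj₁ 2∣1+n

odd-prime⇒even-pred : ∀ {q} → Prime q → q ≢ 2 → 2 ∣ q ∸ 1
odd-prime⇒even-pred {zero} q-prime _ = ⊥-elim (¬prime[0] q-prime)
odd-prime⇒even-pred {suc q} q-prime q≢2 with even-or-succ-even q
... | inj₁ 2∣q = 2∣q
... | inj₂ 2∣1+q with prime⇒irreducible q-prime 2∣1+q
...   | inj₁ ()
...   | inj₂ 2≡1+q = ⊥-elim (q≢2 (sym 2≡1+q))

odd-prime-∣-double : ∀ {q h} → Prime q → q ≢ 2 → q ∣ 2 ℕ.* h → q ∣ h
odd-prime-∣-double {q} {h} q-prime q≢2 q∣2h with euclidsLemma 2 h q-prime q∣2h
... | inj₂ q∣h = q∣h
... | inj₁ q∣2 with prime⇒irreducible prime[2] q∣2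
...   | inj₁ q≡1 = ⊥-elim (¬prime[1] (subst Prime q≡1 q-prime))
...   | inj₂ q≡2 = ⊥-elim (q≢2 q≡2)

pred-as-ℤ : ∀ l → .{{NonZero l}} → + (l ∸ 1) ≡ + l - + 1
pred-as-ℤ (suc l) = refl

infix 4 _≡_mod_

_≡_mod_ : ℤ → ℤ → ℤ → Set
a ≡ b mod k = k ∣ℤ a - b

≡mod-refl : ∀ {k} a → a ≡ a mod k
≡mod-refl {k} a = subst (k ∣ℤ_) (sym (ℤP.+-inverseʳ a)) (ℤ∣.divides (+ 0) refl)

≡mod-sym : ∀ {k a b} → a ≡ b mod k → b ≡ a mod k
≡mod-sym {k} {a} {b} a≡b = subst (k ∣ℤ_) (negate-difference a b) (ℤ∣.∣m⇒∣-m a≡b)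
  where
  negate-difference : ∀ a b → - (a - b) ≡ b - a
  negate-difference = solve-∀

≡mod-trans : ∀ {k a b c} → a ≡ b mod k → b ≡ c mod k → a ≡ c mod k
≡mod-trans {k} {a} {b} {c} a≡b b≡c =
  subst (k ∣ℤ_) (telescope a b c) (ℤ∣.∣m∣n⇒∣m+n a≡b b≡c)
  where
  telescope : ∀ a b c → (a - b) + (b - c) ≡ a - c
  telescope = solve-∀

≈⇒≡mod : ∀ {n} (x y : GR n) {k} → x ≈[ k ] y → ∀ g → x g ≡ y g mod + k
≈⇒≡mod x y x≈y g = ℤ∣.∣ᵤ⇒∣ {k = + _} {i = x g - y g} (x≈y g)

≡mod⇒≈ : ∀ {n} (x y : GR n) {k} → (∀ g → x g ≡ y g mod + k) → x ≈[ k ] y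
≡mod⇒≈ x y x≡y g = ℤ∣.∣⇒∣ᵤ (x≡y g)

ΣFin-cong : ∀ {n} {x y : GR n} → (∀ g → x g ≡ y g) → ΣFin x ≡ ΣFin y
ΣFin-cong {zero}  x≡y = refl
ΣFin-cong {suc n} x≡y = cong₂ _+_ (x≡y zero) (ΣFin-cong (λ g → x≡y (suc g)))

ΣFin-*ʳ : ∀ {n} (x : GR n) c → ΣFin (λ g → x g * c) ≡ ΣFin x * c
ΣFin-*ʳ {zero}  x c = sym (ℤP.*-zeroˡ c)
ΣFin-*ʳ {suc n} x c = begin
  x zero * c + ΣFin (λ g → x (suc g) * c) ≡⟨ cong (_+_ (x zero * c)) (ΣFin-*ʳ (λ g → x (suc g)) c) ⟩
  x zero * c + ΣFin (λ g → x (suc g)) * c ≡⟨ ℤP.*-distribʳ-+ c (x zero) _ ⟨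
  ΣFin x * c                              ∎
  where open ≡-Reasoning

ΣFin-⊖ : ∀ {n} (x y : GR n) → ΣFin (x ⊖ y) ≡ ΣFin x - ΣFin y
ΣFin-⊖ {zero}  x y = refl
ΣFin-⊖ {suc n} x y = begin
  (x zero - y zero) + ΣFin (λ g → x (suc g) - y (suc g))
    ≡⟨ cong (_+_ (x zero - y zero)) (ΣFin-⊖ (λ g → x (suc g)) (λ g → y (suc g))) ⟩
  (x zero - y zero) + (ΣFin (λ g → x (suc g)) - ΣFin (λ g → y (suc g)))
    ≡⟨ interchange (x zero) (y zero) _ _ ⟩
  ΣFin x - ΣFin y ∎
  where
  open ≡-Reasoning
  interchange : ∀ a b c d → (a - b) + (c - d) ≡ (a + c) - (b + d)
  interchange = solve-∀

shift : ∀ {n} → ℤ → GR (suc n) → GR (suc n)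
shift a x zero    = x zero + a
shift a x (suc g) = x (suc g)

ΣFin-shift : ∀ {n} a (x : GR (suc n)) → ΣFin (shift a x) ≡ ΣFin x + a
ΣFin-shift a x = move-last (x zero) a (ΣFin (λ g → x (suc g)))
  where
  move-last : ∀ b a s → (b + a) + s ≡ (b + s) + a
  move-last = solve-∀

shift-≡mod : ∀ {n k a} (x : GR (suc n)) → k ∣ℤ a → ∀ g → shift a x g ≡ x g mod k
shift-≡mod {k = k} {a} x k∣a zero = subst (k ∣ℤ_) (sym (cancel (x zero) a)) k∣a
  where
  cancel : ∀ b a → (b + a) - b ≡ a
  cancel = solve-∀
shift-≡mod x k∣a (suc g) = ≡mod-refl (x (suc g))

normalise : ∀ {n} → GR (suc n) → GR (suc n)
normalise y = shift (- ΣFin y) y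

ΣFin-normalise : ∀ {n} (y : GR (suc n)) → ΣFin (normalise y) ≡ + 0
ΣFin-normalise y = trans (ΣFin-shift (- ΣFin y) y) (ℤP.+-inverseʳ (ΣFin y))

normalise-≡mod : ∀ {n k} (y : GR (suc n)) → k ∣ℤ ΣFin y → ∀ g → normalise y g ≡ y g mod k
normalise-≡mod y k∣Σy = shift-≡mod y (ℤ∣.∣m⇒∣-m k∣Σy)

module Correspondence
  (p l : ℕ)
  (l∣h      : + l ∣ℤ + ((p ∸ 1) / 2))
  (h∣m      : + ((p ∸ 1) / 2) ∣ℤ + (p ∸ 1))
  (m∣h[l-1] : + (p ∸ 1) ∣ℤ + ((p ∸ 1) / 2) * (+ l - + 1))
  where

  private
    M H L : ℤ
    M = + (p ∸ 1)
    H = + ((p ∸ 1) / 2)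
    L = + l

  I-trace : ∀ {n} (x : GR n) → InI p x → H ∣ℤ ΣFin x
  I-trace x x∈I = ℤ∣.∣ᵤ⇒∣ {k = H} {i = ΣFin x} x∈I

  l∣trace : ∀ {n} (x : GR n) → InI p x → L ∣ℤ ΣFin x
  l∣trace x x∈I = ℤ∣.∣-trans l∣h (I-trace x x∈I)

  trace-zero∈I : ∀ {n} (x : GR n) → ΣFin x ≡ + 0 → InI p x
  trace-zero∈I x Σx≡0 = ℤ∣.∣⇒∣ᵤ (subst (H ∣ℤ_) (sym Σx≡0) (ℤ∣.divides (+ 0) refl))

  IlI-eq⇒≡mod-l : ∀ {n} {x y : GR n} → IlI-eq p l x y → ∀ g → x g ≡ y g mod L
  IlI-eq⇒≡mod-l {x = x} {y} (z , _ , x-y≡lz) g =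
    ℤ∣.∣m+n∣n⇒∣m l∣x-y-lz (ℤ∣.∣m⇒∣-m (ℤ∣.∣m⇒∣m*n (z g) (ℤ∣.∣-refl {L})))
    where
    l∣x-y-lz : L ∣ℤ (x g - y g) - L * z g
    l∣x-y-lz = ℤ∣.∣-trans (ℤ∣.∣-trans l∣h h∣m) (ℤ∣.∣ᵤ⇒∣ (x-y≡lz g))

  -- Conversely, elements of I which are coefficientwise congruent mod l are
  -- equal in I/lI: if x - y = l·w, then x - y ≡ l·z (mod m) for the element
  -- z = w + (Σ w)(l - 1)[1] of I.
  ≡mod-l⇒IlI-eq : ∀ {n} (x y : GR (suc n)) → InI p x → InI p y →
    (∀ g → x g ≡ y g mod L) → IlI-eq p l x y
  ≡mod-l⇒IlI-eq x y x∈I y∈I x≡y = z , z∈I , λ g → ℤ∣.∣⇒∣ᵤ (d≡lz g)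
    where
    open ≡-Reasoning
    d = x ⊖ y
    w = λ g → ℤ∣._∣_.quotient (x≡y g)

    d≡wl : ∀ g → d g ≡ w g * L
    d≡wl g = ℤ∣._∣_.equality (x≡y g)

    Σd≡Σw*l : ΣFin d ≡ ΣFin w * L
    Σd≡Σw*l = trans (ΣFin-cong d≡wl) (ΣFin-*ʳ w L)

    h∣Σd : H ∣ℤ ΣFin d
    h∣Σd = subst (H ∣ℤ_) (sym (ΣFin-⊖ x y))
      (ℤ∣.∣m∣n⇒∣m-n (I-trace x x∈I) (I-trace y y∈I))

    z = shift (ΣFin w * (L - + 1)) w

    Σz≡Σd : ΣFin z ≡ ΣFin d
    Σz≡Σd = begin
      ΣFin z                          ≡⟨ ΣFin-shift _ w ⟩
      ΣFin w + ΣFin w * (L - + 1)     ≡⟨ collect (ΣFin w) L ⟩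
      ΣFin w * L                      ≡⟨ Σd≡Σw*l ⟨
      ΣFin d                          ∎
      where
      collect : ∀ s l → s + s * (l - + 1) ≡ s * l
      collect = solve-∀

    z∈I : InI p z
    z∈I = ℤ∣.∣⇒∣ᵤ (subst (H ∣ℤ_) (sym Σz≡Σd) h∣Σd)

    -- Only the corrected coefficient differs from l·w, by -(Σ d)(l - 1).
    d≡lz : ∀ g → M ∣ℤ d g - L * z g
    d≡lz zero = subst (M ∣ℤ_) (sym correction)
      (ℤ∣.∣m⇒∣-m (ℤ∣.∣-trans m∣h[l-1] (ℤ∣.*-monoˡ-∣ (L - + 1) h∣Σd)))
      where
      expand : ∀ w₀ s l → w₀ * l - l * (w₀ + s * (l - + 1)) ≡ - (s * l * (l - + 1))
      expand = solve-∀
      correction : d zero - L * z zero ≡ - (ΣFin d * (L - + 1))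
      correction = begin
        d zero - L * z zero                    ≡⟨ cong (_- L * z zero) (d≡wl zero) ⟩
        w zero * L - L * z zero                ≡⟨ expand (w zero) (ΣFin w) L ⟩
        - (ΣFin w * L * (L - + 1))             ≡⟨ cong (λ s → - (s * (L - + 1))) Σd≡Σw*l ⟨
        - (ΣFin d * (L - + 1))                 ∎
    d≡lz (suc g) = subst (M ∣ℤ_) (sym vanish) (ℤ∣.divides (+ 0) refl)
      where
      vanish : d (suc g) - L * z (suc g) ≡ + 0
      vanish = trans (cong (_- L * w (suc g)) (d≡wl (suc g))) (commute (w (suc g)) L)
        where
        commute : ∀ w l → w * l - l * w ≡ + 0
        commute = solve-∀

  normalise∈I : ∀ {n} (y : GR (suc n)) → InI p (normalise y)
  normalise∈I y = trace-zero∈I (normalise y) (ΣFin-normalise y)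

  B-trace : ∀ {n} (y : GR n) → InB l y → L ∣ℤ ΣFin y
  B-trace y y∈B = ℤ∣.∣ᵤ⇒∣ {k = L} {i = ΣFin y} y∈B

  normalise-resp : ∀ {n} (y y′ : GR (suc n)) → InB l y → InB l y′ → y ≈[ l ] y′ →
    ∀ g → normalise y g ≡ normalise y′ g mod L
  normalise-resp y y′ y∈B y′∈B y≈y′ g =
    ≡mod-trans {a = normalise y g} {y g} {normalise y′ g} (normalise-≡mod y (B-trace y y∈B) g)
      (≡mod-trans {a = y g} {y′ g} {normalise y′ g} (≈⇒≡mod y y′ y≈y′ g)
        (≡mod-sym {a = normalise y′ g} (normalise-≡mod y′ (B-trace y′ y′∈B) g)))

  isomorphism : ∀ {n} (G : FiniteGroup (suc n)) → ModIso G p l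
  isomorphism G = record
    { φ       = id
    ; ψ       = normalise
    ; φ-into  = λ x x∈I → ℤ∣.∣⇒∣ᵤ (l∣trace x x∈I)
    ; ψ-into  = λ y _ → normalise∈I y
    ; φ-resp  = λ x x′ _ _ x~x′ → ≡mod⇒≈ x x′ (IlI-eq⇒≡mod-l {x = x} {x′} x~x′)
    ; ψ-resp  = λ y y′ y∈B y′∈B y≈y′ →
        ≡mod-l⇒IlI-eq (normalise y) (normalise y′) (normalise∈I y) (normalise∈I y′)
          (normalise-resp y y′ y∈B y′∈B y≈y′)
    ; ψφ      = λ x x∈I →
        ≡mod-l⇒IlI-eq (normalise x) x (normalise∈I x) x∈I (normalise-≡mod x (l∣trace x x∈I))
    ; φψ      = λ y y∈B → ≡mod⇒≈ (normalise y) y (normalise-≡mod y (B-trace y y∈B))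
    ; φ-add   = λ x x′ _ _ → ≡mod⇒≈ (x ⊕ x′) (x ⊕ x′) (λ g → ≡mod-refl ((x ⊕ x′) g))
    ; φ-equiv = λ g x _ → ≡mod⇒≈ (act G g x) (act G g x) (λ h → ≡mod-refl (act G g x h))
    }

proposition3p2 : ∀ (n : ℕ) (G : FiniteGroup n) (p l : ℕ) →
    Prime p → p ≢ 2 → Prime l → l ≢ 2 → l ∣ p ∸ 1 →
    ModIso G p l
proposition3p2 zero G _ _ _ _ _ _ _ with FiniteGroup.e G
... | ()
proposition3p2 (suc n) G p l p-prime p≢2 l-prime l≢2 l∣m =
  Correspondence.isomorphism p l (ℤ∣.∣ᵤ⇒∣ l∣h) (ℤ∣.∣ᵤ⇒∣ h∣m) m∣h[l-1] G
  where
  m = p ∸ 1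
  h = m / 2
  instance _ = prime⇒nonZero l-prime

  2h≡m : 2 ℕ.* h ≡ m
  2h≡m = m*[n/m]≡n (odd-prime⇒even-pred p-prime p≢2)

  l∣h : l ∣ h
  l∣h = odd-prime-∣-double l-prime l≢2 (subst (l ∣_) (sym 2h≡m) l∣m)

  h∣m : h ∣ m
  h∣m = subst (h ∣_) 2h≡m (ℕ∣.n∣m*n 2)

  m∣h[l-1] : + m ∣ℤ + h * (+ l - + 1)
  m∣h[l-1] = subst (+ m ∣ℤ_) (trans (ℤP.pos-* h (l ∸ 1)) (cong (+ h *_) (pred-as-ℤ l)))
    (ℤ∣.∣ᵤ⇒∣ (subst (_∣ h ℕ.* (l ∸ 1)) (trans (ℕP.*-comm h 2) 2h≡m)
      (ℕ∣.*-monoʳ-∣ h (odd-prime⇒even-pred l-prime l≢2))))
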